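{- Let $G$ be a free partially commutative group. For each $x\in G$, the number of join-irreducible elements $y\in G$ with $y\le x$ is equal to $|x|$.
   Context: $G$ is generated by $g_1,\dots,g_k$ with relations $g_ig_j=g_jg_i$ for $\{i,j\}$ in a given set $E$ of unordered pairs. Symbols $g_i^{\pm1}$; $g_i^{\pm1}$, $g_j^{\pm1}$ independent if $\{i,j\}\in E$. A word is reduced if it is not of the form $xaya^{ -1}z$ with $a$ a symbol independent of every symbol of $y$; $|x|$ is the length of any reduced word representing $x$. $x\le y$ means there are reduced words representing $x$ and $y$ with the first a beginning segment of the second; $\vee$ is the least upper bound when it exists. $x$ is join-irreducible if $x\ne1$ and $y\vee z=x$ implies $y=x$ or $z=x$. -}

module Defs where

open import Data.Nat using (ℕ)
open import Data.Fin using (Fin)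
open import Data.Bool using (Bool; true; false; not)
open import Data.Product using (Σ; _×_; _,_; ∃; ∃-syntax; proj₁; proj₂)
open import Data.Sum using (_⊎_)
open import Data.List using (List; []; _∷_; _++_; length)
open import Data.List.Relation.Unary.All using (All)
open import Data.List.Relation.Unary.Any using (Any)
open import Data.List.Relation.Unary.AllPairs using (AllPairs)
open import Relation.Binary.PropositionalEquality using (_≡_; _≢_)
open import Relation.Nullary using (¬_)

-- E is given as a Bool-valued function; the unordered pair {i,j} is in E
-- iff  E i j ≡ true  or  E j i ≡ true  (diagonal entries are ignored,
-- pairs being 2-element sets).
module FPCG (k : ℕ) (E : Fin k → Fin k → Bool) where

  -- a symbol g_i^{+1} is (i , true), g_i^{-1} is (i , false)
  Symbol : Set
  Symbol = Fin k × Bool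

  gen : Symbol → Fin k
  gen = proj₁

  inv : Symbol → Symbol
  inv (i , s) = (i , not s)

  Word : Set
  Word = List Symbol

  InE : Fin k → Fin k → Set
  InE i j = (E i j ≡ true) ⊎ (E j i ≡ true)

  Indep : Symbol → Symbol → Set
  Indep a b = (gen a ≢ gen b) × InE (gen a) (gen b)

  data _≈G_ : Word → Word → Set where
    ≈refl  : ∀ {u} → u ≈G u
    ≈sym   : ∀ {u v} → u ≈G v → v ≈G u
    ≈trans : ∀ {u v w} → u ≈G v → v ≈G w → u ≈G w
    cancel : ∀ u v a → (u ++ a ∷ inv a ∷ v) ≈G (u ++ v)
    comm   : ∀ u v i j → InE i j →
             (u ++ (i , true) ∷ (j , true) ∷ v) ≈G (u ++ (j , true) ∷ (i , true) ∷ v)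

  infix 4 _≈G_ _≤G_

  IndepAll : Symbol → Word → Set
  IndepAll a y = All (Indep a) y

  Reduced : Word → Set
  Reduced w = ¬ (Σ Word λ x → Σ Symbol λ a → Σ Word λ y → Σ Word λ z →
                   (w ≡ x ++ a ∷ y ++ inv a ∷ z) × IndepAll a y)

  _≤G_ : Word → Word → Set
  x ≤G y = Σ Word λ u → Σ Word λ t →
             Reduced u × Reduced (u ++ t) × (u ≈G x) × ((u ++ t) ≈G y)

  IsJoin : Word → Word → Word → Set
  IsJoin y z x = (y ≤G x) × (z ≤G x) × (∀ w → y ≤G w → z ≤G w → x ≤G w)

  JoinIrreducible : Word → Set
  JoinIrreducible x = ¬ (x ≈G []) × (∀ y z → IsJoin y z x → (y ≈G x) ⊎ (z ≈G x))

module Submission where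

-- Fix a reduced word r representing x.  A selection of positions of r is an ideal if every
-- unselected letter commutes with all selected letters after it; the selected subword of an
-- ideal is then a prefix of r up to commutations.  Ideals of r represent the elements below x
-- bijectively, with ≤ given by inclusion and ∨ by union.  Hence the join-irreducible elements
-- below x are represented by the join-prime ideals, and these are the principal ideals, one
-- generated by each of the |x| = length r positions of r.

open import Defs
open import Data.Nat using (ℕ; zero; suc; pred; _+_; _⊔_; _≤_; z≤n; _≤?_)
open import Data.Nat.Properties using (m≤m+n; m≤n⇒m⊔n≡n; ⊔-comm; pred-mono-≤; ∸-distribʳ-⊔; +-suc; n≮n; ≤-<-trans)
open import Data.Fin using (Fin) renaming (_≟_ to _≟F_)
open import Data.Bool using (Bool; true; false; not; _∨_; if_then_else_)
open import Data.Bool.Properties using () renaming (_≟_ to _≟B_)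
open import Data.Product using (Σ; _×_; _,_; proj₁; proj₂)
open import Data.Product.Properties using (≡-dec)
open import Data.Sum using (_⊎_; inj₁; inj₂; [_,_]′)
open import Data.Maybe using (Maybe; just; nothing)
import Data.Maybe as Maybe
open import Data.Maybe.Properties using (map-nothing)
open import Data.List using (List; []; _∷_; _++_; length; map; drop)
open import Data.List.Properties using (++-assoc; ++-identityʳ; length-++; length-map; ∷-injectiveˡ; ∷-injectiveʳ)
open import Data.List.Relation.Unary.All using (All; []; _∷_)
import Data.List.Relation.Unary.All as All
open import Data.List.Relation.Unary.All.Properties using () renaming (map⁺ to All-map⁺)
open import Data.List.Relation.Unary.Any using (Any; here; there)
import Data.List.Relation.Unary.Any as Any
open import Data.List.Relation.Unary.Any.Properties using () renaming (map⁺ to Any-map⁺)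
open import Data.List.Relation.Unary.AllPairs using (AllPairs; []; _∷_)
import Data.List.Relation.Unary.AllPairs as AllPairs
open import Data.List.Relation.Unary.AllPairs.Properties using () renaming (map⁺ to AllPairs-map⁺)
open import Data.List.Membership.Propositional using (_∈_)
open import Data.Empty using (⊥; ⊥-elim)
open import Data.Unit using (⊤; tt)
open import Relation.Binary.PropositionalEquality
open import Relation.Nullary using (¬_; Dec; yes; no; does)
open import Relation.Nullary.Decidable using (_×-dec_; _⊎-dec_; ¬?)

module Development (k : ℕ) (E : Fin k → Fin k → Bool) where

  open FPCG k E

  -- kept opaque so that case splits on these decisions abstract cleanly in goals
  infix 4 _≟S_
  opaque
    _≟S_ : (a b : Symbol) → Dec (a ≡ b)
    _≟S_ = ≡-dec _≟F_ _≟B_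

  InE-sym : ∀ {i j} → InE i j → InE j i
  InE-sym (inj₁ e) = inj₂ e
  InE-sym (inj₂ e) = inj₁ e

  Indep? : (a b : Symbol) → Dec (Indep a b)
  Indep? a b = ¬? (gen a ≟F gen b) ×-dec ((E (gen a) (gen b) ≟B true) ⊎-dec (E (gen b) (gen a) ≟B true))

  Dep : Symbol → Symbol → Set
  Dep a b = ¬ Indep a b

  indep-sym : ∀ {a b} → Indep a b → Indep b a
  indep-sym (ne , ie) = (λ eq → ne (sym eq)) , InE-sym ie

  dep-sym : ∀ {a b} → Dep a b → Dep b a
  dep-sym {a} {b} d i = d (indep-sym {b} {a} i)

  dep-refl : ∀ a → Dep a a
  dep-refl a (ne , _) = ne refl

  indep-≢ : ∀ {a b} → Indep a b → a ≢ b
  indep-≢ (ne , _) refl = ne refl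

  inv-inv : ∀ a → inv (inv a) ≡ a
  inv-inv (i , true) = refl
  inv-inv (i , false) = refl

  -- Projection onto a pair {c , d} of letters: the subword of letters equal to c or d.
  -- For a dependent pair the relative order of these letters is invariant under
  -- commutations, which makes projections the basic invariant of the whole proof.

  InPair : Symbol → Symbol → Symbol → Set
  InPair c d x = (x ≡ c) ⊎ (x ≡ d)

  opaque
    inPair? : ∀ c d x → Dec (InPair c d x)
    inPair? c d x = (x ≟S c) ⊎-dec (x ≟S d)

  proj : Symbol → Symbol → Word → Word
  proj c d [] = []
  proj c d (x ∷ w) = if does (inPair? c d x) then x ∷ proj c d w else proj c d w

  proj-in : ∀ {c d x} w → InPair c d x → proj c d (x ∷ w) ≡ x ∷ proj c d w
  proj-in {c} {d} {x} w p with inPair? c d x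
  ... | yes _ = refl
  ... | no np = ⊥-elim (np p)

  proj-out : ∀ {c d x} w → ¬ InPair c d x → proj c d (x ∷ w) ≡ proj c d w
  proj-out {c} {d} {x} w np with inPair? c d x
  ... | yes p = ⊥-elim (np p)
  ... | no _ = refl

  proj-++ : ∀ c d u v → proj c d (u ++ v) ≡ proj c d u ++ proj c d v
  proj-++ c d [] v = refl
  proj-++ c d (x ∷ u) v with inPair? c d x
  ... | yes _ = cong (x ∷_) (proj-++ c d u v)
  ... | no _ = proj-++ c d u v

  proj-inPair : ∀ c d w → All (InPair c d) (proj c d w)
  proj-inPair c d [] = []
  proj-inPair c d (x ∷ w) with inPair? c d x
  ... | yes p = p ∷ proj-inPair c d w
  ... | no _ = proj-inPair c d w

  dep-pair : ∀ {c d a b} → Dep c d → InPair c d a → InPair c d b → Dep a b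
  dep-pair {c} dcd (inj₁ refl) (inj₁ refl) = dep-refl c
  dep-pair dcd (inj₁ refl) (inj₂ refl) = dcd
  dep-pair {c} {d} dcd (inj₂ refl) (inj₁ refl) = dep-sym {c} {d} dcd
  dep-pair {d = d} dcd (inj₂ refl) (inj₂ refl) = dep-refl d

  indep-out : ∀ {c d x} → Dep c d → Indep c x → ¬ InPair c d x
  indep-out {c} dcd ix (inj₁ refl) = dep-refl c ix
  indep-out dcd ix (inj₂ refl) = dcd ix

  infix 4 _≡π_
  record _≡π_ (u v : Word) : Set where
    constructor π-equal
    field at : ∀ c d → Dep c d → proj c d u ≡ proj c d v
  open _≡π_

  ≡π-refl : ∀ {u} → u ≡π u
  ≡π-refl = π-equal λ _ _ _ → refl

  ≡π-≡ : ∀ {u v} → u ≡ v → u ≡π v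
  ≡π-≡ refl = ≡π-refl

  ≡π-sym : ∀ {u v} → u ≡π v → v ≡π u
  ≡π-sym p = π-equal λ c d dcd → sym (at p c d dcd)

  ≡π-trans : ∀ {u v w} → u ≡π v → v ≡π w → u ≡π w
  ≡π-trans p q = π-equal λ c d dcd → trans (at p c d dcd) (at q c d dcd)

  ≡π-++ : ∀ {u u′ v v′} → u ≡π u′ → v ≡π v′ → (u ++ v) ≡π (u′ ++ v′)
  ≡π-++ {u} {u′} {v} {v′} p q = π-equal λ c d dcd → begin
    proj c d (u ++ v)              ≡⟨ proj-++ c d u v ⟩
    proj c d u ++ proj c d v       ≡⟨ cong₂ _++_ (at p c d dcd) (at q c d dcd) ⟩
    proj c d u′ ++ proj c d v′     ≡⟨ proj-++ c d u′ v′ ⟨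
    proj c d (u′ ++ v′)            ∎
    where open ≡-Reasoning

  ≡π-uncons : ∀ b {u v} → (b ∷ u) ≡π (b ∷ v) → u ≡π v
  ≡π-uncons b {u} {v} p = π-equal λ c d dcd → drop-head c d (at p c d dcd)
    where
    drop-head : ∀ c d → proj c d (b ∷ u) ≡ proj c d (b ∷ v) → proj c d u ≡ proj c d v
    drop-head c d e with inPair? c d b
    ... | yes _ = ∷-injectiveʳ e
    ... | no _ = e

  infix 4 _~_
  data _~_ : Word → Word → Set where
    ~refl  : ∀ {u} → u ~ u
    ~trans : ∀ {u v w} → u ~ v → v ~ w → u ~ w
    ~swap  : ∀ u v a b → Indep a b → (u ++ a ∷ b ∷ v) ~ (u ++ b ∷ a ∷ v)

  ~sym : ∀ {u v} → u ~ v → v ~ u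
  ~sym ~refl = ~refl
  ~sym (~trans p q) = ~trans (~sym q) (~sym p)
  ~sym (~swap u v a b i) = ~swap u v b a (indep-sym {a} {b} i)

  ~-cons : ∀ x {u v} → u ~ v → (x ∷ u) ~ (x ∷ v)
  ~-cons x ~refl = ~refl
  ~-cons x (~trans p q) = ~trans (~-cons x p) (~-cons x q)
  ~-cons x (~swap u v a b i) = ~swap (x ∷ u) v a b i

  ~-move : ∀ x y z → All (Indep x) y → (x ∷ y ++ z) ~ (y ++ x ∷ z)
  ~-move x [] z [] = ~refl
  ~-move x (b ∷ y) z (i ∷ al) = ~trans (~swap [] (y ++ z) x b i) (~-cons b (~-move x y z al))

  ~-length : ∀ {u v} → u ~ v → length u ≡ length v
  ~-length ~refl = refl
  ~-length (~trans p q) = trans (~-length p) (~-length q)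
  ~-length (~swap u v a b i) = trans (length-++ u) (sym (length-++ u))

  proj-swap : ∀ c d a b v → Dep c d → Indep a b → proj c d (a ∷ b ∷ v) ≡ proj c d (b ∷ a ∷ v)
  proj-swap c d a b v dcd iab with inPair? c d a | inPair? c d b
  ... | yes pa | yes pb = ⊥-elim (dep-pair dcd pa pb iab)
  ... | yes _  | no _   = refl
  ... | no _   | yes _  = refl
  ... | no _   | no _   = refl

  ~⇒≡π : ∀ {u v} → u ~ v → u ≡π v
  ~⇒≡π ~refl = ≡π-refl
  ~⇒≡π (~trans p q) = ≡π-trans (~⇒≡π p) (~⇒≡π q)
  ~⇒≡π (~swap u v a b i) = ≡π-++ (≡π-refl {u}) (π-equal λ c d dcd → proj-swap c d a b v dcd i)

  prefixWith : Word → Word × Word → Word × Word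
  prefixWith y (u , z) = (y ++ u , z)

  extract : Symbol → Word → Maybe (Word × Word)
  extract c [] = nothing
  extract c (x ∷ t) with x ≟S c
  ... | yes _ = just ([] , t)
  ... | no _ with Indep? c x
  ...   | yes _ = Maybe.map (prefixWith (x ∷ [])) (extract c t)
  ...   | no _ = nothing

  extract-sound : ∀ c t {y z} → extract c t ≡ just (y , z) → (t ≡ y ++ c ∷ z) × All (Indep c) y
  extract-sound c [] ()
  extract-sound c (x ∷ t) e with x ≟S c
  extract-sound c (x ∷ t) refl | yes refl = refl , []
  ... | no _ with Indep? c x
  ...   | no _ with e
  ...     | ()
  extract-sound c (x ∷ t) e | no _ | yes ix with extract c t in e′
  extract-sound c (x ∷ t) refl | no _ | yes ix | just (y , z) with extract-sound c t e′
  ... | refl , al = refl , ix ∷ al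
  extract-sound c (x ∷ t) () | no _ | yes ix | nothing

  extract-past : ∀ c y w → All (Indep c) y → extract c (y ++ w) ≡ Maybe.map (prefixWith y) (extract c w)
  extract-past c [] w [] with extract c w
  ... | just _ = refl
  ... | nothing = refl
  extract-past c (x ∷ y) w (ix ∷ al) with x ≟S c
  ... | yes refl = ⊥-elim (indep-≢ {c} {c} ix refl)
  ... | no _ with Indep? c x
  ...   | no nix = ⊥-elim (nix ix)
  ...   | yes _ rewrite extract-past c y w al with extract c w
  ...     | just _ = refl
  ...     | nothing = refl

  extract-hit : ∀ c y z → All (Indep c) y → extract c (y ++ c ∷ z) ≡ just (y , z)
  extract-hit c y z al rewrite extract-past c y (c ∷ z) al with c ≟S c
  ... | yes _ = cong (λ u → just (u , z)) (++-identityʳ y)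
  ... | no ne = ⊥-elim (ne refl)

  extract-proj : ∀ c d t {y z} → Dep c d → extract c t ≡ just (y , z) → proj c d t ≡ c ∷ proj c d (y ++ z)
  extract-proj c d t {y} {z} dcd e with extract-sound c t e
  ... | refl , al = trans (at (~⇒≡π (~sym (~-move c y z al))) c d dcd) (proj-in (y ++ z) (inj₁ refl))

  StartsWith : Symbol → Word → Set
  StartsWith c l = Σ Word λ rest → l ≡ c ∷ rest

  extract-fail : ∀ c t → extract c t ≡ nothing → Σ Symbol λ d → Dep c d × ¬ StartsWith c (proj c d t)
  extract-fail c [] e = c , dep-refl c , λ { (_ , ()) }
  extract-fail c (x ∷ t) e with x ≟S c
  extract-fail c (x ∷ t) () | yes _
  ... | no x≢c with Indep? c x
  ...   | no dx = x , dx , λ (rest , eq) → x≢c (∷-injectiveˡ (trans (sym (proj-in t (inj₂ refl))) eq))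
  ...   | yes ix with extract c t in e′
  extract-fail c (x ∷ t) () | no _ | yes ix | just _
  ... | nothing with extract-fail c t e′
  ... | d , dcd , ns = d , dcd , λ sw → ns (subst (StartsWith c) (proj-out t (indep-out dcd ix)) sw)

  extract-nothing-cong : ∀ c t t′ → (∀ d → Dep c d → proj c d t ≡ proj c d t′) →
                         extract c t ≡ nothing → extract c t′ ≡ nothing
  extract-nothing-cong c t t′ agree e with extract c t′ in e′
  ... | nothing = refl
  ... | just (y , z) with extract-fail c t e
  ...   | d , dcd , ns = ⊥-elim (ns (proj c d (y ++ z) , trans (agree d dcd) (extract-proj c d t′ dcd e′)))

  -- The first letter b of v must be extractable from u, since every projection of u onto a pair {b , d}
  -- starts with b; after moving it to the front, induction applies to the rest.
  ≡π⇒~ : ∀ u v → u ≡π v → u ~ v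
  ≡π⇒~ [] [] p = ~refl
  ≡π⇒~ (x ∷ u) [] p with trans (sym (proj-in u (inj₁ refl))) (at p x x (dep-refl x))
  ... | ()
  ≡π⇒~ u (b ∷ v) p with extract b u in e
  ... | just (y , z) with extract-sound b u e
  ...   | refl , al = ~trans (~sym (~-move b y z al)) (~-cons b (≡π⇒~ (y ++ z) v rest))
    where
    rest : (y ++ z) ≡π v
    rest = ≡π-uncons b (≡π-trans (~⇒≡π (~-move b y z al)) p)
  ≡π⇒~ u (b ∷ v) p | nothing with extract-fail b u e
  ... | d , dbd , ns = ⊥-elim (ns (proj b d v , trans (at p b d dbd) (proj-in v (inj₁ refl))))

  ≡π-length : ∀ {u v} → u ≡π v → length u ≡ length v
  ≡π-length {u} {v} p = ~-length (≡π⇒~ u v p)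

  ≈-ctx : ∀ p s {u v} → u ≈G v → (p ++ u ++ s) ≈G (p ++ v ++ s)
  ≈-ctx p s ≈refl = ≈refl
  ≈-ctx p s (≈sym q) = ≈sym (≈-ctx p s q)
  ≈-ctx p s (≈trans q q′) = ≈trans (≈-ctx p s q) (≈-ctx p s q′)
  ≈-ctx p s (cancel u v a) =
    subst₂ _≈G_ (sym (around u (a ∷ inv a ∷ v))) (sym (around u v)) (cancel (p ++ u) (v ++ s) a)
    where
    around : ∀ u w → p ++ (u ++ w) ++ s ≡ (p ++ u) ++ (w ++ s)
    around u w = trans (cong (p ++_) (++-assoc u w s)) (sym (++-assoc p u (w ++ s)))
  ≈-ctx p s (comm u v i j ie) =
    subst₂ _≈G_ (sym (around u ((i , true) ∷ (j , true) ∷ v))) (sym (around u ((j , true) ∷ (i , true) ∷ v)))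
      (comm (p ++ u) (v ++ s) i j ie)
    where
    around : ∀ u w → p ++ (u ++ w) ++ s ≡ (p ++ u) ++ (w ++ s)
    around u w = trans (cong (p ++_) (++-assoc u w s)) (sym (++-assoc p u (w ++ s)))

  ≈-mixed : ∀ i j → InE i j → ((i , false) ∷ (j , true) ∷ []) ≈G ((j , true) ∷ (i , false) ∷ [])
  ≈-mixed i j ie =
    ≈trans (≈sym (cancel ((i , false) ∷ (j , true) ∷ []) [] (i , true)))
      (≈trans (comm ((i , false) ∷ []) ((i , false) ∷ []) j i (InE-sym ie))
              (cancel [] ((j , true) ∷ (i , false) ∷ []) (i , false)))

  ≈-indep-swap : ∀ a b → Indep a b → (a ∷ b ∷ []) ≈G (b ∷ a ∷ [])
  ≈-indep-swap (i , true) (j , true) (_ , ie) = comm [] [] i j ie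
  ≈-indep-swap (i , false) (j , true) (_ , ie) = ≈-mixed i j ie
  ≈-indep-swap (i , true) (j , false) (_ , ie) = ≈sym (≈-mixed j i (InE-sym ie))
  ≈-indep-swap (i , false) (j , false) (_ , ie) =
    ≈trans (≈sym (cancel [] ((i , false) ∷ (j , false) ∷ []) (j , false)))
      (≈trans (≈-ctx ((j , false) ∷ []) ((j , false) ∷ []) (≈sym (≈-mixed i j ie)))
              (cancel ((j , false) ∷ (i , false) ∷ []) [] (j , true)))

  ~⇒≈ : ∀ {u v} → u ~ v → u ≈G v
  ~⇒≈ ~refl = ≈refl
  ~⇒≈ (~trans p q) = ≈trans (~⇒≈ p) (~⇒≈ q)
  ~⇒≈ (~swap u v a b i) = ≈-ctx u v (≈-indep-swap a b i)

  ≡π⇒≈ : ∀ {u v} → u ≡π v → u ≈G v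
  ≡π⇒≈ {u} {v} p = ~⇒≈ (≡π⇒~ u v p)

  -- Reducedness, recursively: no letter x can meet an inverse x⁻¹ extracted from the rest.
  -- Reduced′ is equivalent to Reduced (both directions below) but can be used inductively.

  Reduced′ : Word → Set
  Reduced′ [] = ⊤
  Reduced′ (x ∷ w) = (extract (inv x) w ≡ nothing) × Reduced′ w

  Reduced′⇒Reduced : ∀ w → Reduced′ w → Reduced w
  Reduced′⇒Reduced w r (x , a , y , z , eq , al) = go w x eq r
    where
    go : ∀ w x → w ≡ x ++ a ∷ y ++ inv a ∷ z → Reduced′ w → ⊥
    go w [] refl (s , _) with trans (sym (extract-hit (inv a) y z al)) s
    ... | ()
    go w (b ∷ x) refl (_ , r) = go _ x refl r

  Reduced⇒Reduced′ : ∀ w → Reduced w → Reduced′ w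
  Reduced⇒Reduced′ [] r = tt
  Reduced⇒Reduced′ (x ∷ w) r = head , Reduced⇒Reduced′ w λ (p , a , y , z , eq , al) → r (x ∷ p , a , y , z , cong (x ∷_) eq , al)
    where
    head : extract (inv x) w ≡ nothing
    head with extract (inv x) w in e
    ... | nothing = refl
    ... | just (y , z) with extract-sound (inv x) w e
    ...   | eq , al = ⊥-elim (r ([] , x , y , z , cong (x ∷_) eq , al))

  map-nothing⁻ : ∀ {A B : Set} {f : A → B} (m : Maybe A) → Maybe.map f m ≡ nothing → m ≡ nothing
  map-nothing⁻ nothing e = refl

  extract-nothing-≡π : ∀ c {t t′} → t ≡π t′ → extract c t ≡ nothing → extract c t′ ≡ nothing
  extract-nothing-≡π c {t} {t′} p = extract-nothing-cong c t t′ λ d dcd → at p c d dcd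

  reduced′-swap : ∀ u v a b → Indep a b → Reduced′ (u ++ a ∷ b ∷ v) → Reduced′ (u ++ b ∷ a ∷ v)
  reduced′-swap [] v a b iab (sa , sb , r) =
    trans (extract-past (inv b) (a ∷ []) v (indep-sym {a} {b} iab ∷ [])) (map-nothing sb) ,
    map-nothing⁻ (extract (inv a) v) (trans (sym (extract-past (inv a) (b ∷ []) v (iab ∷ []))) sa) , r
  reduced′-swap (x ∷ u) v a b iab (s , r) =
    extract-nothing-≡π (inv x) (~⇒≡π (~swap u v a b iab)) s ,
    reduced′-swap u v a b iab r

  reduced′-~ : ∀ {u v} → u ~ v → Reduced′ u → Reduced′ v
  reduced′-~ ~refl r = r
  reduced′-~ (~trans p q) r = reduced′-~ q (reduced′-~ p r)
  reduced′-~ (~swap u v a b i) r = reduced′-swap u v a b i r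

  extract-nothing-prefix : ∀ c u t → extract c (u ++ t) ≡ nothing → extract c u ≡ nothing
  extract-nothing-prefix c [] t e = refl
  extract-nothing-prefix c (x ∷ u) t e with x ≟S c
  extract-nothing-prefix c (x ∷ u) t () | yes _
  ... | no _ with Indep? c x
  ...   | no _ = refl
  ...   | yes _ = map-nothing (extract-nothing-prefix c u t (map-nothing⁻ (extract c (u ++ t)) e))

  reduced′-prefix : ∀ u t → Reduced′ (u ++ t) → Reduced′ u
  reduced′-prefix [] t r = tt
  reduced′-prefix (x ∷ u) t (s , r) = extract-nothing-prefix (inv x) u t s , reduced′-prefix u t r

  reduced′-suffix : ∀ u t → Reduced′ (u ++ t) → Reduced′ t
  reduced′-suffix [] t r = r
  reduced′-suffix (x ∷ u) t (s , r) = reduced′-suffix u t r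

  -- Iterating push gives a normal form that respects ≈G up to ≡π, so reduced words that
  -- are equal in G are projection equivalent, i.e. shuffle equivalent.

  push : Symbol → Word → Word
  push a t with extract (inv a) t
  ... | just (y , z) = y ++ z
  ... | nothing = a ∷ t

  push-just : ∀ a t {y z} → extract (inv a) t ≡ just (y , z) → push a t ≡ y ++ z
  push-just a t e with extract (inv a) t
  push-just a t refl | just _ = refl

  push-nothing : ∀ a t → extract (inv a) t ≡ nothing → push a t ≡ a ∷ t
  push-nothing a t e with extract (inv a) t
  push-nothing a t refl | nothing = refl

  cancels : Symbol → Word → Bool
  cancels a t = Maybe.is-just (extract (inv a) t)

  -- the effect of push a on a projection onto {c , d}, given whether inv a cancels
  projPush : Symbol → Symbol → Symbol → Bool → Word → Word
  projPush a c d true l = if does (inPair? c d (inv a)) then drop 1 l else l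
  projPush a c d false l = if does (inPair? c d a) then a ∷ l else l

  proj-push : ∀ a c d t → Dep c d → proj c d (push a t) ≡ projPush a c d (cancels a t) (proj c d t)
  proj-push a c d t dcd with extract (inv a) t in e
  ... | just (y , z) with extract-sound (inv a) t e
  ...   | refl , al rewrite at (~⇒≡π (~sym (~-move (inv a) y z al))) c d dcd with inPair? c d (inv a)
  ...     | yes _ = refl
  ...     | no _ = refl
  proj-push a c d t dcd | nothing with inPair? c d a
  ... | yes _ = refl
  ... | no _ = refl

  cancels-cong : ∀ a t t′ → (∀ d → Dep (inv a) d → proj (inv a) d t ≡ proj (inv a) d t′) →
                 cancels a t ≡ cancels a t′
  cancels-cong a t t′ agree with extract (inv a) t in e | extract (inv a) t′ in e′
  ... | just _ | just _ = refl
  ... | nothing | nothing = refl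
  ... | nothing | just _ with trans (sym e′) (extract-nothing-cong (inv a) t t′ agree e)
  ...   | ()
  cancels-cong a t t′ agree | just _ | nothing
      with trans (sym e) (extract-nothing-cong (inv a) t′ t (λ d dd → sym (agree d dd)) e′)
  ... | ()

  push-cong : ∀ a {t t′} → t ≡π t′ → push a t ≡π push a t′
  push-cong a {t} {t′} p = π-equal λ c d dcd → begin
    proj c d (push a t)                                   ≡⟨ proj-push a c d t dcd ⟩
    projPush a c d (cancels a t) (proj c d t)              ≡⟨ cong₂ (projPush a c d) (cancels-cong a t t′ λ d′ dd → at p (inv a) d′ dd)
                                                                                      (at p c d dcd) ⟩
    projPush a c d (cancels a t′) (proj c d t′)            ≡⟨ proj-push a c d t′ dcd ⟨
    proj c d (push a t′)                                  ∎
    where open ≡-Reasoning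

  Touches : Symbol → Symbol → Symbol → Set
  Touches c d a = InPair c d a ⊎ InPair c d (inv a)

  projPush-id : ∀ a c d f l → ¬ Touches c d a → projPush a c d f l ≡ l
  projPush-id a c d true l nt with inPair? c d (inv a)
  ... | yes p = ⊥-elim (nt (inj₂ p))
  ... | no _ = refl
  projPush-id a c d false l nt with inPair? c d a
  ... | yes p = ⊥-elim (nt (inj₁ p))
  ... | no _ = refl

  touch-excl : ∀ {c d a b} → Dep c d → Indep a b → Touches c d a → ¬ Touches c d b
  touch-excl {a = a} {b} dcd iab (inj₁ pa) (inj₁ pb) = dep-pair {a = a} {b} dcd pa pb iab
  touch-excl {a = a} {b} dcd iab (inj₁ pa) (inj₂ pb) = dep-pair {a = a} {inv b} dcd pa pb iab
  touch-excl {a = a} {b} dcd iab (inj₂ pa) (inj₁ pb) = dep-pair {a = inv a} {b} dcd pa pb iab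
  touch-excl {a = a} {b} dcd iab (inj₂ pa) (inj₂ pb) = dep-pair {a = inv a} {inv b} dcd pa pb iab

  projPush-comm : ∀ a b c d fa fb l → Dep c d → Indep a b →
                  projPush a c d fa (projPush b c d fb l) ≡ projPush b c d fb (projPush a c d fa l)
  projPush-comm a b c d fa fb l dcd iab with inPair? c d a ⊎-dec inPair? c d (inv a)
  ... | yes ta = trans (cong (projPush a c d fa) (projPush-id b c d fb l nb))
                       (sym (projPush-id b c d fb (projPush a c d fa l) nb))
    where nb = touch-excl {a = a} {b} dcd iab ta
  ... | no na = trans (projPush-id a c d fa (projPush b c d fb l) na)
                      (cong (projPush b c d fb) (sym (projPush-id a c d fa l na)))

  cancels-push : ∀ a b t → Indep a b → cancels a (push b t) ≡ cancels a t
  cancels-push a b t iab = cancels-cong a (push b t) t λ d dd →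
    trans (proj-push b (inv a) d t dd)
          (projPush-id b (inv a) d (cancels b t) (proj (inv a) d t)
             [ indep-out {inv a} {d} {b} dd iab , indep-out {inv a} {d} {inv b} dd iab ]′)

  push-comm : ∀ a b t → Indep a b → push a (push b t) ≡π push b (push a t)
  push-comm a b t iab = π-equal λ c d dcd → begin
    proj c d (push a (push b t))
      ≡⟨ proj-push a c d (push b t) dcd ⟩
    projPush a c d (cancels a (push b t)) (proj c d (push b t))
      ≡⟨ cong₂ (projPush a c d) (cancels-push a b t iab) (proj-push b c d t dcd) ⟩
    projPush a c d (cancels a t) (projPush b c d (cancels b t) (proj c d t))
      ≡⟨ projPush-comm a b c d (cancels a t) (cancels b t) (proj c d t) dcd iab ⟩
    projPush b c d (cancels b t) (projPush a c d (cancels a t) (proj c d t))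
      ≡⟨ cong₂ (projPush b c d) (cancels-push b a t (indep-sym {a} {b} iab)) (proj-push a c d t dcd) ⟨
    projPush b c d (cancels b (push a t)) (proj c d (push a t))
      ≡⟨ proj-push b c d (push a t) dcd ⟨
    proj c d (push b (push a t))
      ∎
    where open ≡-Reasoning

  push-cancel : ∀ a t → Reduced′ t → push (inv a) (push a t) ≡π t
  push-cancel a t r with extract (inv a) t in e
  ... | just (y , z) with extract-sound (inv a) t e
  ...   | refl , al = ≡π-trans (≡π-≡ (push-nothing (inv a) (y ++ z) no-a)) (~⇒≡π (~-move (inv a) y z al))
    where
    no-a : extract (inv (inv a)) (y ++ z) ≡ nothing
    no-a = trans (extract-past (inv (inv a)) y z al) (map-nothing (proj₁ (reduced′-suffix y (inv a ∷ z) r)))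
  push-cancel a t r | nothing =
    ≡π-≡ (push-just (inv a) (a ∷ t) (subst (λ q → extract q (a ∷ t) ≡ just ([] , t)) (sym (inv-inv a)) (extract-hit a [] t [])))

  push-reduced : ∀ a t → Reduced′ t → Reduced′ (push a t)
  push-reduced a t r with extract (inv a) t in e
  ... | just (y , z) with extract-sound (inv a) t e
  ...   | refl , al = proj₂ (reduced′-~ (~sym (~-move (inv a) y z al)) r)
  push-reduced a t r | nothing = e , r

  normalize : Word → Word
  normalize [] = []
  normalize (a ∷ w) = push a (normalize w)

  pushAll : Word → Word → Word
  pushAll [] s = s
  pushAll (a ∷ u) s = push a (pushAll u s)

  normalize-++ : ∀ u v → normalize (u ++ v) ≡ pushAll u (normalize v)
  normalize-++ [] v = refl
  normalize-++ (a ∷ u) v = cong (push a) (normalize-++ u v)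

  pushAll-cong : ∀ u {s s′} → s ≡π s′ → pushAll u s ≡π pushAll u s′
  pushAll-cong [] p = p
  pushAll-cong (a ∷ u) p = push-cong a (pushAll-cong u p)

  normalize-reduced : ∀ w → Reduced′ (normalize w)
  normalize-reduced [] = tt
  normalize-reduced (a ∷ w) = push-reduced a (normalize w) (normalize-reduced w)

  normalize-≈ : ∀ {u v} → u ≈G v → normalize u ≡π normalize v
  normalize-≈ ≈refl = ≡π-refl
  normalize-≈ (≈sym p) = ≡π-sym (normalize-≈ p)
  normalize-≈ (≈trans p q) = ≡π-trans (normalize-≈ p) (normalize-≈ q)
  normalize-≈ (cancel u v a) rewrite normalize-++ u (a ∷ inv a ∷ v) | normalize-++ u v =
    pushAll-cong u (subst (λ q → push q (push (inv a) (normalize v)) ≡π normalize v) (inv-inv a)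
                      (push-cancel (inv a) (normalize v) (normalize-reduced v)))
  normalize-≈ (comm u v i j ie) rewrite normalize-++ u ((i , true) ∷ (j , true) ∷ v)
                                      | normalize-++ u ((j , true) ∷ (i , true) ∷ v) with i ≟F j
  ... | yes refl = ≡π-refl
  ... | no i≢j = pushAll-cong u (push-comm (i , true) (j , true) (normalize v) (i≢j , ie))

  normalize-id : ∀ u → Reduced′ u → normalize u ≡π u
  normalize-id [] r = ≡π-refl
  normalize-id (a ∷ u) (s , r) = ≡π-trans (push-cong a (normalize-id u r)) (≡π-≡ (push-nothing a u s))

  reduced-≈⇒≡π : ∀ {u v} → Reduced′ u → Reduced′ v → u ≈G v → u ≡π v
  reduced-≈⇒≡π {u} {v} ru rv p =
    ≡π-trans (≡π-sym (normalize-id u ru)) (≡π-trans (normalize-≈ p) (normalize-id v rv))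

  infixr 5 _∷ˢ_
  data Sel : Word → Set where
    stop : Sel []
    _∷ˢ_ : ∀ {x r} → Bool → Sel r → Sel (x ∷ r)

  chosen : ∀ r → Sel r → Word
  chosen [] stop = []
  chosen (x ∷ r) (true ∷ˢ S) = x ∷ chosen r S
  chosen (x ∷ r) (false ∷ˢ S) = chosen r S

  unchosen : ∀ r → Sel r → Word
  unchosen [] stop = []
  unchosen (x ∷ r) (true ∷ˢ S) = unchosen r S
  unchosen (x ∷ r) (false ∷ˢ S) = x ∷ unchosen r S

  Ideal : ∀ r → Sel r → Set
  Ideal [] stop = ⊤
  Ideal (x ∷ r) (true ∷ˢ S) = Ideal r S
  Ideal (x ∷ r) (false ∷ˢ S) = All (Indep x) (chosen r S) × Ideal r S

  ideal-tail : ∀ x r b (S : Sel r) → Ideal (x ∷ r) (b ∷ˢ S) → Ideal r S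
  ideal-tail x r true S i = i
  ideal-tail x r false S (_ , i) = i

  ideal-split : ∀ r S → Ideal r S → r ~ (chosen r S ++ unchosen r S)
  ideal-split [] stop _ = ~refl
  ideal-split (x ∷ r) (true ∷ˢ S) i = ~-cons x (ideal-split r S i)
  ideal-split (x ∷ r) (false ∷ˢ S) (al , i) =
    ~trans (~-cons x (ideal-split r S i)) (~-move x (chosen r S) (unchosen r S) al)

  full empty : ∀ r → Sel r
  full [] = stop
  full (x ∷ r) = true ∷ˢ full r
  empty [] = stop
  empty (x ∷ r) = false ∷ˢ empty r

  _++ˢ_ : ∀ {p s} → Sel p → Sel s → Sel (p ++ s)
  stop ++ˢ T = T
  (b ∷ˢ S) ++ˢ T = b ∷ˢ (S ++ˢ T)

  chosen-full : ∀ r → chosen r (full r) ≡ r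
  chosen-full [] = refl
  chosen-full (x ∷ r) = cong (x ∷_) (chosen-full r)

  chosen-empty : ∀ r → chosen r (empty r) ≡ []
  chosen-empty [] = refl
  chosen-empty (x ∷ r) = chosen-empty r

  chosen-prefix : ∀ p s → chosen (p ++ s) (full p ++ˢ empty s) ≡ p
  chosen-prefix [] s = chosen-empty s
  chosen-prefix (x ∷ p) s = cong (x ∷_) (chosen-prefix p s)

  ideal-full : ∀ r → Ideal r (full r)
  ideal-full [] = tt
  ideal-full (x ∷ r) = ideal-full r

  ideal-empty : ∀ r → Ideal r (empty r)
  ideal-empty [] = tt
  ideal-empty (x ∷ r) = subst (All (Indep x)) (sym (chosen-empty r)) [] , ideal-empty r

  count : Word → Symbol → ℕ
  count [] c = 0
  count (x ∷ u) c = if does (x ≟S c) then suc (count u c) else count u c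

  count-self : ∀ x u → count (x ∷ u) x ≡ suc (count u x)
  count-self x u with x ≟S x
  ... | yes _ = refl
  ... | no ne = ⊥-elim (ne refl)

  count-other : ∀ x u c → x ≢ c → count (x ∷ u) c ≡ count u c
  count-other x u c ne with x ≟S c
  ... | yes e = ⊥-elim (ne e)
  ... | no _ = refl

  count-indep : ∀ x u → All (Indep x) u → count u x ≡ 0
  count-indep x [] [] = refl
  count-indep x (y ∷ u) (i ∷ al) = trans (count-other y u x (λ e → indep-≢ {x} {y} i (sym e))) (count-indep x u al)

  count-++ : ∀ u v c → count (u ++ v) c ≡ count u c + count v c
  count-++ [] v c = refl
  count-++ (x ∷ u) v c with does (x ≟S c)
  ... | true = cong suc (count-++ u v c)
  ... | false = count-++ u v c

  count-proj : ∀ c d u x → InPair c d x → count (proj c d u) x ≡ count u x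
  count-proj c d [] x p = refl
  count-proj c d (y ∷ u) x p with inPair? c d y
  ... | yes _ with does (y ≟S x)
  ...   | true = cong suc (count-proj c d u x p)
  ...   | false = count-proj c d u x p
  count-proj c d (y ∷ u) x p | no y∉ = trans (count-proj c d u x p) (sym (count-other y u x λ { refl → y∉ p }))

  ≡π-count : ∀ {u v} → u ≡π v → ∀ c → count u c ≡ count v c
  ≡π-count {u} {v} p c = begin
    count u c              ≡⟨ count-proj c c u c (inj₁ refl) ⟨
    count (proj c c u) c   ≡⟨ cong (λ w → count w c) (at p c c (dep-refl c)) ⟩
    count (proj c c v) c   ≡⟨ count-proj c c v c (inj₁ refl) ⟩
    count v c              ∎
    where open ≡-Reasoning

  -- firsts r f selects, from left to right, the first f a occurrences of every letter a in r.

  lower : Symbol → (Symbol → ℕ) → Symbol → ℕ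
  lower c f y = if does (y ≟S c) then pred (f y) else f y

  firsts : ∀ r → (Symbol → ℕ) → Sel r
  firsts [] f = stop
  firsts (x ∷ r) f with f x
  ... | zero = false ∷ˢ firsts r f
  ... | suc _ = true ∷ˢ firsts r (lower x f)

  firsts-skip : ∀ x r f → f x ≡ 0 → firsts (x ∷ r) f ≡ false ∷ˢ firsts r f
  firsts-skip x r f e rewrite e = refl

  firsts-take : ∀ x r f {n} → f x ≡ suc n → firsts (x ∷ r) f ≡ true ∷ˢ firsts r (lower x f)
  firsts-take x r f e rewrite e = refl

  lower-other : ∀ x f y → y ≢ x → lower x f y ≡ f y
  lower-other x f y ne with y ≟S x
  ... | yes e = ⊥-elim (ne e)
  ... | no _ = refl

  lower-count : ∀ x u y → lower x (count (x ∷ u)) y ≡ count u y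
  lower-count x u y with y ≟S x
  ... | yes refl = cong pred (count-self y u)
  ... | no ne = count-other x u y (λ e → ne (sym e))

  Agree : Word → (Symbol → ℕ) → (Symbol → ℕ) → Set
  Agree r f g = All (λ y → f y ≡ g y) r

  agree-all : ∀ r {f g} → (∀ y → f y ≡ g y) → Agree r f g
  agree-all [] h = []
  agree-all (x ∷ r) h = h x ∷ agree-all r h

  firsts-agree : ∀ r f g → Agree r f g → firsts r f ≡ firsts r g
  firsts-agree [] f g _ = refl
  firsts-agree (x ∷ r) f g (e ∷ al) with f x in ef | g x in eg
  ... | zero | zero = cong (false ∷ˢ_) (firsts-agree r f g al)
  ... | suc _ | suc _ = cong (true ∷ˢ_) (firsts-agree r (lower x f) (lower x g) (All.map lower-cong al))
    where
    lower-cong : ∀ {y} → f y ≡ g y → lower x f y ≡ lower x g y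
    lower-cong {y} e = cong (λ n → if does (y ≟S x) then pred n else n) e
  firsts-agree (x ∷ r) f g (() ∷ al) | zero | suc _
  firsts-agree (x ∷ r) f g (() ∷ al) | suc _ | zero

  firsts-lower-proj : ∀ c d x r f → ¬ InPair c d x → firsts (proj c d r) (lower x f) ≡ firsts (proj c d r) f
  firsts-lower-proj c d x r f x∉ =
    firsts-agree (proj c d r) _ _ (All.map (λ {y} py → lower-other x f y λ { refl → x∉ py }) (proj-inPair c d r))

  firsts-zero : ∀ r → firsts r (λ _ → 0) ≡ empty r
  firsts-zero [] = refl
  firsts-zero (x ∷ r) = cong (false ∷ˢ_) (firsts-zero r)

  firsts-prefix : ∀ p s → firsts (p ++ s) (count p) ≡ full p ++ˢ empty s
  firsts-prefix [] s = firsts-zero s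
  firsts-prefix (x ∷ p) s rewrite firsts-take x (p ++ s) (count (x ∷ p)) (count-self x p) =
    cong (true ∷ˢ_) (trans (firsts-agree (p ++ s) _ _ (agree-all (p ++ s) (lower-count x p))) (firsts-prefix p s))

  proj-firsts : ∀ c d r f → proj c d (chosen r (firsts r f)) ≡ chosen (proj c d r) (firsts (proj c d r) f)
  proj-firsts c d [] f = refl
  proj-firsts c d (x ∷ r) f with f x in ef
  ... | zero with inPair? c d x
  ...   | yes _ rewrite ef = proj-firsts c d r f
  ...   | no _ = proj-firsts c d r f
  proj-firsts c d (x ∷ r) f | suc _ with inPair? c d x
  ...   | yes _ rewrite ef = cong (x ∷_) (proj-firsts c d r (lower x f))
  ...   | no x∉ = trans (proj-firsts c d r (lower x f)) (cong (chosen (proj c d r)) (firsts-lower-proj c d x r f x∉))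

  firsts-count : ∀ r S → Ideal r S → firsts r (count (chosen r S)) ≡ S
  firsts-count [] stop _ = refl
  firsts-count (x ∷ r) (true ∷ˢ S) i rewrite firsts-take x r (count (x ∷ chosen r S)) (count-self x (chosen r S)) =
    cong (true ∷ˢ_) (trans (firsts-agree r _ _ (agree-all r (lower-count x (chosen r S)))) (firsts-count r S i))
  firsts-count (x ∷ r) (false ∷ˢ S) (al , i) rewrite firsts-skip x r (count (chosen r S)) (count-indep x (chosen r S) al) =
    cong (false ∷ˢ_) (firsts-count r S i)

  NoneChosen : ∀ {w} → Sel w → Set
  NoneChosen stop = ⊤
  NoneChosen (true ∷ˢ S) = ⊥
  NoneChosen (false ∷ˢ S) = NoneChosen S

  Initial : ∀ {w} → Sel w → Set
  Initial stop = ⊤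
  Initial (true ∷ˢ S) = Initial S
  Initial (false ∷ˢ S) = NoneChosen S

  noneChosen⇒initial : ∀ {w} (S : Sel w) → NoneChosen S → Initial S
  noneChosen⇒initial stop _ = tt
  noneChosen⇒initial (false ∷ˢ S) n = n

  chosen-none : ∀ w (S : Sel w) → NoneChosen S → chosen w S ≡ []
  chosen-none [] stop _ = refl
  chosen-none (x ∷ w) (false ∷ˢ S) n = chosen-none w S n

  noneChosen-empty : ∀ w → NoneChosen (empty w)
  noneChosen-empty [] = tt
  noneChosen-empty (x ∷ w) = noneChosen-empty w

  initial-prefix : ∀ p s → Initial (full p ++ˢ empty s)
  initial-prefix [] [] = tt
  initial-prefix [] (x ∷ s) = noneChosen-empty s
  initial-prefix (x ∷ p) s = initial-prefix p s

  proj-nonempty : ∀ c d {y} u → y ∈ u → InPair c d y → proj c d u ≢ []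
  proj-nonempty c d (x ∷ u) (here refl) p rewrite proj-in u p = λ ()
  proj-nonempty c d (x ∷ u) (there m) p with inPair? c d x
  ... | yes _ = λ ()
  ... | no _ = proj-nonempty c d u m p

  -- An unselected x cannot be followed by a selected y dependent on x, since on the pair {x , y}
  -- the unselected x would precede the selected y.
  ideal-criterion : ∀ r f → (∀ c d → Dep c d → Initial (firsts (proj c d r) f)) → Ideal r (firsts r f)
  ideal-criterion [] f H = tt
  ideal-criterion (x ∷ r) f H with f x in ef
  ... | zero = All.tabulate commutes , ideal-criterion r f H′
    where
    H′ : ∀ c d → Dep c d → Initial (firsts (proj c d r) f)
    H′ c d dcd with inPair? c d x | H c d dcd
    ... | yes _ | h rewrite ef = noneChosen⇒initial (firsts (proj c d r) f) h
    ... | no _  | h = h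
    commutes : ∀ {y} → y ∈ chosen r (firsts r f) → Indep x y
    commutes {y} m with Indep? x y
    ... | yes i = i
    ... | no dxy with inPair? x y x | H x y dxy
    ...   | no x∉ | _ = ⊥-elim (x∉ (inj₁ refl))
    ...   | yes _ | h rewrite ef = ⊥-elim (
      proj-nonempty x y (chosen r (firsts r f)) m (inj₂ refl)
        (trans (proj-firsts x y r f) (chosen-none (proj x y r) (firsts (proj x y r) f) h)))
  ... | suc _ = ideal-criterion r (lower x f) H′
    where
    H′ : ∀ c d → Dep c d → Initial (firsts (proj c d r) (lower x f))
    H′ c d dcd with inPair? c d x | H c d dcd
    ... | yes _ | h rewrite ef = h
    ... | no x∉ | h = subst Initial (sym (firsts-lower-proj c d x r f x∉)) h

  firsts-literal-prefix : ∀ w p s f → w ≡ p ++ s → Agree w f (count p) →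
                          Initial (firsts w f) × (chosen w (firsts w f) ≡ p)
  firsts-literal-prefix _ p s f refl ag rewrite firsts-agree (p ++ s) f (count p) ag | firsts-prefix p s =
    initial-prefix p s , chosen-prefix p s

  proj-split : ∀ c d r u t → Dep c d → (u ++ t) ≡π r → proj c d r ≡ proj c d u ++ proj c d t
  proj-split c d r u t dcd p = trans (sym (at p c d dcd)) (proj-++ c d u t)

  agree-proj : ∀ c d r u → Agree (proj c d r) (count u) (count (proj c d u))
  agree-proj c d r u = All.map (λ {y} py → sym (count-proj c d u y py)) (proj-inPair c d r)

  -- On each dependent pair the projection of u is a
  -- literal prefix of the projection of r.
  prefix-ideal : ∀ r u t → (u ++ t) ≡π r →
                 Ideal r (firsts r (count u)) × (u ≡π chosen r (firsts r (count u)))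
  prefix-ideal r u t p =
    ideal-criterion r (count u) (λ c d dcd → proj₁ (onPair c d dcd)) ,
    π-equal λ c d dcd → sym (trans (proj-firsts c d r (count u)) (proj₂ (onPair c d dcd)))
    where
    onPair : ∀ c d → Dep c d → Initial (firsts (proj c d r) (count u)) ×
                               (chosen (proj c d r) (firsts (proj c d r) (count u)) ≡ proj c d u)
    onPair c d dcd = firsts-literal-prefix (proj c d r) (proj c d u) (proj c d t) (count u)
                       (proj-split c d r u t dcd p) (agree-proj c d r u)

  -- The join of two prefixes.  Two literal prefixes of one word are comparable; selecting by the
  -- larger of their counts selects the longer one.

  longer : Word → Word → Word
  longer a b with length a ≤? length b
  ... | yes _ = b
  ... | no _ = a

  longer-ext : ∀ a m → longer a (a ++ m) ≡ a ++ m
  longer-ext a m with length a ≤? length (a ++ m)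
  ... | yes _ = refl
  ... | no n = ⊥-elim (n (subst (length a ≤_) (sym (length-++ a)) (m≤m+n (length a) (length m))))

  longer-ext′ : ∀ a m → longer (a ++ m) a ≡ a ++ m
  longer-ext′ a [] with length (a ++ []) ≤? length a
  ... | yes _ = sym (++-identityʳ a)
  ... | no _ = refl
  longer-ext′ a (x ∷ m) with length (a ++ x ∷ m) ≤? length a
  ... | no _ = refl
  ... | yes le = ⊥-elim (n≮n (length a) (≤-<-trans (m≤m+n (length a) (length m))
                          (subst (_≤ length a) (trans (length-++ a) (+-suc (length a) (length m))) le)))

  comparable : ∀ (p₁ q₁ p₂ q₂ : Word) → p₁ ++ q₁ ≡ p₂ ++ q₂ →
               (Σ Word λ m → p₂ ≡ p₁ ++ m) ⊎ (Σ Word λ m → p₁ ≡ p₂ ++ m)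
  comparable [] q₁ p₂ q₂ e = inj₁ (p₂ , refl)
  comparable (x ∷ p₁) q₁ [] q₂ e = inj₂ (x ∷ p₁ , refl)
  comparable (x ∷ p₁) q₁ (y ∷ p₂) q₂ e with ∷-injectiveˡ e | comparable p₁ q₁ p₂ q₂ (∷-injectiveʳ e)
  ... | refl | inj₁ (m , eq) = inj₁ (m , cong (x ∷_) eq)
  ... | refl | inj₂ (m , eq) = inj₂ (m , cong (x ∷_) eq)

  countMax : Word → Word → Symbol → ℕ
  countMax a₁ a₂ y = count a₁ y ⊔ count a₂ y

  countMax-ext : ∀ p m y → countMax p (p ++ m) y ≡ count (p ++ m) y
  countMax-ext p m y = m≤n⇒m⊔n≡n (subst (count p y ≤_) (sym (count-++ p m y)) (m≤m+n (count p y) (count m y)))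

  join-on-pair : ∀ l p₁ q₁ p₂ q₂ h → l ≡ p₁ ++ q₁ → l ≡ p₂ ++ q₂ → Agree l h (countMax p₁ p₂) →
                 Initial (firsts l h) × (chosen l (firsts l h) ≡ longer p₁ p₂)
  join-on-pair l p₁ q₁ p₂ q₂ h e₁ e₂ ag with comparable p₁ q₁ p₂ q₂ (trans (sym e₁) e₂)
  ... | inj₁ (m , refl) rewrite longer-ext p₁ m =
    firsts-literal-prefix l (p₁ ++ m) q₂ h e₂ (All.map (λ {y} e → trans e (countMax-ext p₁ m y)) ag)
  ... | inj₂ (m , refl) rewrite longer-ext′ p₂ m =
    firsts-literal-prefix l (p₂ ++ m) q₁ h e₁
      (All.map (λ {y} e → trans e (trans (⊔-comm (count (p₂ ++ m) y) (count p₂ y)) (countMax-ext p₂ m y))) ag)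

  join-ideal : ∀ w a₁ b₁ a₂ b₂ → (a₁ ++ b₁) ≡π w → (a₂ ++ b₂) ≡π w →
    Ideal w (firsts w (countMax a₁ a₂)) ×
    (∀ c d → Dep c d → proj c d (chosen w (firsts w (countMax a₁ a₂))) ≡ longer (proj c d a₁) (proj c d a₂))
  join-ideal w a₁ b₁ a₂ b₂ p₁ p₂ =
    ideal-criterion w h (λ c d dcd → proj₁ (onPair c d dcd)) ,
    λ c d dcd → trans (proj-firsts c d w h) (proj₂ (onPair c d dcd))
    where
    h = countMax a₁ a₂
    onPair : ∀ c d → Dep c d → Initial (firsts (proj c d w) h) ×
                               (chosen (proj c d w) (firsts (proj c d w) h) ≡ longer (proj c d a₁) (proj c d a₂))
    onPair c d dcd =
      join-on-pair (proj c d w) (proj c d a₁) (proj c d b₁) (proj c d a₂) (proj c d b₂) h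
        (proj-split c d w a₁ b₁ dcd p₁) (proj-split c d w a₂ b₂ dcd p₂)
        (All.map (λ {y} py → sym (cong₂ _⊔_ (count-proj c d a₁ y py) (count-proj c d a₂ y py))) (proj-inPair c d w))

  noneChosen-length : ∀ w (S : Sel w) → length (chosen w S) ≡ 0 → NoneChosen S
  noneChosen-length [] stop _ = tt
  noneChosen-length (x ∷ w) (true ∷ˢ S) ()
  noneChosen-length (x ∷ w) (false ∷ˢ S) e = noneChosen-length w S e

  infix 4 _⊆ˢ_
  _⊆ˢ_ : ∀ {r} → Sel r → Sel r → Set
  stop ⊆ˢ stop = ⊤
  (a ∷ˢ S) ⊆ˢ (b ∷ˢ T) = (a ≡ true → b ≡ true) × (S ⊆ˢ T)

  infixr 6 _∪ˢ_
  _∪ˢ_ : ∀ {r} → Sel r → Sel r → Sel r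
  stop ∪ˢ stop = stop
  (a ∷ˢ S) ∪ˢ (b ∷ˢ T) = (a ∨ b) ∷ˢ (S ∪ˢ T)

  ⊆-antisym : ∀ {r} (A B : Sel r) → A ⊆ˢ B → B ⊆ˢ A → A ≡ B
  ⊆-antisym stop stop _ _ = refl
  ⊆-antisym (true ∷ˢ A) (true ∷ˢ B) (_ , s) (_ , t) = cong (true ∷ˢ_) (⊆-antisym A B s t)
  ⊆-antisym (false ∷ˢ A) (false ∷ˢ B) (_ , s) (_ , t) = cong (false ∷ˢ_) (⊆-antisym A B s t)
  ⊆-antisym (true ∷ˢ A) (false ∷ˢ B) (h , _) _ with h refl
  ... | ()
  ⊆-antisym (false ∷ˢ A) (true ∷ˢ B) _ (h , _) with h refl
  ... | ()

  ⊆-∪ˡ : ∀ {r} (A B : Sel r) → A ⊆ˢ A ∪ˢ B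
  ⊆-∪ˡ stop stop = tt
  ⊆-∪ˡ (true ∷ˢ A) (b ∷ˢ B) = (λ _ → refl) , ⊆-∪ˡ A B
  ⊆-∪ˡ (false ∷ˢ A) (b ∷ˢ B) = (λ ()) , ⊆-∪ˡ A B

  ⊆-∪ʳ : ∀ {r} (A B : Sel r) → B ⊆ˢ A ∪ˢ B
  ⊆-∪ʳ stop stop = tt
  ⊆-∪ʳ (true ∷ˢ A) (b ∷ˢ B) = (λ _ → refl) , ⊆-∪ʳ A B
  ⊆-∪ʳ (false ∷ˢ A) (b ∷ˢ B) = (λ e → e) , ⊆-∪ʳ A B

  ∪-⊆ : ∀ {r} (A B S : Sel r) → A ∪ˢ B ≡ S → (A ⊆ˢ S) × (B ⊆ˢ S)
  ∪-⊆ A B S refl = ⊆-∪ˡ A B , ⊆-∪ʳ A B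

  empty-⊆ : ∀ {r} (S : Sel r) → empty r ⊆ˢ S
  empty-⊆ stop = tt
  empty-⊆ (b ∷ˢ S) = (λ ()) , empty-⊆ S

  ⊆-full : ∀ {r} (S : Sel r) → S ⊆ˢ full r
  ⊆-full stop = tt
  ⊆-full (b ∷ˢ S) = (λ _ → refl) , ⊆-full S

  ∪-empty : ∀ {r} (S : Sel r) → S ∪ˢ empty r ≡ S
  ∪-empty stop = refl
  ∪-empty (true ∷ˢ S) = cong (true ∷ˢ_) (∪-empty S)
  ∪-empty (false ∷ˢ S) = cong (false ∷ˢ_) (∪-empty S)

  chosen-⊆ : ∀ {P : Symbol → Set} r (A B : Sel r) → A ⊆ˢ B → All P (chosen r B) → All P (chosen r A)
  chosen-⊆ [] stop stop _ al = al
  chosen-⊆ (x ∷ r) (true ∷ˢ A) (true ∷ˢ B) (_ , s) (p ∷ al) = p ∷ chosen-⊆ r A B s al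
  chosen-⊆ (x ∷ r) (true ∷ˢ A) (false ∷ˢ B) (h , s) al with h refl
  ... | ()
  chosen-⊆ (x ∷ r) (false ∷ˢ A) (true ∷ˢ B) (_ , s) (p ∷ al) = chosen-⊆ r A B s al
  chosen-⊆ (x ∷ r) (false ∷ˢ A) (false ∷ˢ B) (_ , s) al = chosen-⊆ r A B s al

  chosen-∪ : ∀ r (A B : Sel r) {y} → y ∈ chosen r (A ∪ˢ B) → y ∈ chosen r A ⊎ y ∈ chosen r B
  chosen-∪ [] stop stop ()
  chosen-∪ (x ∷ r) (true ∷ˢ A) (b ∷ˢ B) (here e) = inj₁ (here e)
  chosen-∪ (x ∷ r) (true ∷ˢ A) (true ∷ˢ B) (there m) with chosen-∪ r A B m
  ... | inj₁ m′ = inj₁ (there m′)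
  ... | inj₂ m′ = inj₂ (there m′)
  chosen-∪ (x ∷ r) (true ∷ˢ A) (false ∷ˢ B) (there m) with chosen-∪ r A B m
  ... | inj₁ m′ = inj₁ (there m′)
  ... | inj₂ m′ = inj₂ m′
  chosen-∪ (x ∷ r) (false ∷ˢ A) (true ∷ˢ B) (here e) = inj₂ (here e)
  chosen-∪ (x ∷ r) (false ∷ˢ A) (true ∷ˢ B) (there m) with chosen-∪ r A B m
  ... | inj₁ m′ = inj₁ m′
  ... | inj₂ m′ = inj₂ (there m′)
  chosen-∪ (x ∷ r) (false ∷ˢ A) (false ∷ˢ B) m = chosen-∪ r A B m

  ideal-∪ : ∀ r (A B : Sel r) → Ideal r A → Ideal r B → Ideal r (A ∪ˢ B)
  ideal-∪ [] stop stop _ _ = tt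
  ideal-∪ (x ∷ r) (true ∷ˢ A) (b ∷ˢ B) iA iB = ideal-∪ r A B iA (ideal-tail x r b B iB)
  ideal-∪ (x ∷ r) (false ∷ˢ A) (true ∷ˢ B) (_ , iA) iB = ideal-∪ r A B iA iB
  ideal-∪ (x ∷ r) (false ∷ˢ A) (false ∷ˢ B) (aA , iA) (aB , iB) =
    All.tabulate (λ m → [ All.lookup aA , All.lookup aB ]′ (chosen-∪ r A B m)) , ideal-∪ r A B iA iB

  lower-mono : ∀ x f g → (∀ y → f y ≤ g y) → ∀ y → lower x f y ≤ lower x g y
  lower-mono x f g h y with does (y ≟S x)
  ... | true = pred-mono-≤ (h y)
  ... | false = h y

  firsts-mono : ∀ r f g → (∀ y → f y ≤ g y) → firsts r f ⊆ˢ firsts r g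
  firsts-mono [] f g h = tt
  firsts-mono (x ∷ r) f g h with f x in ef | g x in eg
  ... | zero | zero = (λ ()) , firsts-mono r f g h
  ... | zero | suc _ = (λ ()) , firsts-mono r f (lower x g) h′
    where
    h′ : ∀ y → f y ≤ lower x g y
    h′ y with y ≟S x
    ... | yes refl = subst (_≤ pred (g y)) (sym ef) z≤n
    ... | no _ = h y
  ... | suc _ | suc _ = (λ _ → refl) , firsts-mono r (lower x f) (lower x g) (lower-mono x f g h)
  ... | suc _ | zero with subst₂ _≤_ ef eg (h x)
  ...   | ()

  lower-⊔ : ∀ x f g y → lower x (λ z → f z ⊔ g z) y ≡ lower x f y ⊔ lower x g y
  lower-⊔ x f g y with does (y ≟S x)
  ... | true = ∸-distribʳ-⊔ 1 (f y) (g y)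
  ... | false = refl

  firsts-lower-⊔ : ∀ x r f g → firsts r (lower x (λ y → f y ⊔ g y)) ≡ firsts r (λ y → lower x f y ⊔ lower x g y)
  firsts-lower-⊔ x r f g = firsts-agree r _ _ (agree-all r (lower-⊔ x f g))

  firsts-lower-zero : ∀ x r g → g x ≡ 0 → firsts r g ≡ firsts r (lower x g)
  firsts-lower-zero x r g e = firsts-agree r _ _ (agree-all r λ y → sym (lower-zero y))
    where
    lower-zero : ∀ y → lower x g y ≡ g y
    lower-zero y with y ≟S x
    ... | yes refl = trans (cong pred e) (sym e)
    ... | no _ = refl

  firsts-⊔ : ∀ r f g → firsts r f ∪ˢ firsts r g ≡ firsts r (λ y → f y ⊔ g y)
  firsts-⊔ [] f g = refl
  firsts-⊔ (x ∷ r) f g with f x in ef | g x in eg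
  ... | zero | zero = cong (false ∷ˢ_) (firsts-⊔ r f g)
  ... | suc _ | suc _ = cong (true ∷ˢ_)
        (trans (firsts-⊔ r (lower x f) (lower x g)) (sym (firsts-lower-⊔ x r f g)))
  ... | suc _ | zero = cong (true ∷ˢ_) (trans (cong (firsts r (lower x f) ∪ˢ_) (firsts-lower-zero x r g eg))
        (trans (firsts-⊔ r (lower x f) (lower x g)) (sym (firsts-lower-⊔ x r f g))))
  ... | zero | suc _ = cong (true ∷ˢ_) (trans (cong (_∪ˢ firsts r (lower x g)) (firsts-lower-zero x r f ef))
        (trans (firsts-⊔ r (lower x f) (lower x g)) (sym (firsts-lower-⊔ x r f g))))

  -- Principal ideals: for each position of r, the smallest ideal containing it.  For x ∷ r these
  -- are the first position alone, and the principal ideals P of r, extended by the first position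
  -- exactly when x depends on a letter chosen by P.

  extend : ∀ x r → Sel r → Sel (x ∷ r)
  extend x r P = not (does (All.all? (Indep? x) (chosen r P))) ∷ˢ P

  principals : ∀ r → List (Sel r)
  principals [] = []
  principals (x ∷ r) = (true ∷ˢ empty r) ∷ map (extend x r) (principals r)

  principals-length : ∀ r → length (principals r) ≡ length r
  principals-length [] = refl
  principals-length (x ∷ r) = cong suc (trans (length-map (extend x r) (principals r)) (principals-length r))

  ideal-extend : ∀ x r P → Ideal r P → Ideal (x ∷ r) (extend x r P)
  ideal-extend x r P i with All.all? (Indep? x) (chosen r P)
  ... | yes al = al , i
  ... | no _ = i

  principals-ideal : ∀ r → All (Ideal r) (principals r)
  principals-ideal [] = []
  principals-ideal (x ∷ r) = ideal-empty r ∷ All-map⁺ (All.map (ideal-extend x r _) (principals-ideal r))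

  tailˢ : ∀ {x r} → Sel (x ∷ r) → Sel r
  tailˢ (_ ∷ˢ S) = S

  noneChosen-tail : ∀ {x r} (S : Sel (x ∷ r)) → NoneChosen S → NoneChosen (tailˢ S)
  noneChosen-tail (false ∷ˢ S) n = n

  principals-nonempty : ∀ r → All (λ P → ¬ NoneChosen P) (principals r)
  principals-nonempty [] = []
  principals-nonempty (x ∷ r) =
    (λ ()) ∷ All-map⁺ (All.map (λ {P} n none → n (noneChosen-tail (extend x r P) none)) (principals-nonempty r))

  ∷ˢ-injective : ∀ {x r a b} {S T : Sel r} → _≡_ {A = Sel (x ∷ r)} (a ∷ˢ S) (b ∷ˢ T) → S ≡ T
  ∷ˢ-injective refl = refl

  principals-distinct : ∀ r → AllPairs _≢_ (principals r)
  principals-distinct [] = []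
  principals-distinct (x ∷ r) =
    All-map⁺ (All.map (λ n eq → n (subst NoneChosen (∷ˢ-injective eq) (noneChosen-empty r))) (principals-nonempty r)) ∷
    AllPairs-map⁺ (AllPairs.map (λ ne eq → ne (∷ˢ-injective eq)) (principals-distinct r))

  JoinPrime : ∀ r → Sel r → Set
  JoinPrime r P = ∀ Y Z → Ideal r Y → Ideal r Z → P ⊆ˢ Y ∪ˢ Z → (P ⊆ˢ Y) ⊎ (P ⊆ˢ Z)

  extend-⊆ : ∀ x r P y (Y : Sel r) → Ideal (x ∷ r) (y ∷ˢ Y) → P ⊆ˢ Y → extend x r P ⊆ˢ (y ∷ˢ Y)
  extend-⊆ x r P true Y _ P⊆Y = (λ _ → refl) , P⊆Y
  extend-⊆ x r P false Y (al , _) P⊆Y with All.all? (Indep? x) (chosen r P)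
  ... | yes _ = (λ ()) , P⊆Y
  ... | no ¬al = ⊥-elim (¬al (chosen-⊆ r P Y P⊆Y al))

  joinPrime-extend : ∀ x r P → JoinPrime r P → JoinPrime (x ∷ r) (extend x r P)
  joinPrime-extend x r P prime (y ∷ˢ Y) (z ∷ˢ Z) iY iZ (_ , P⊆Y∪Z)
    with prime Y Z (ideal-tail x r y Y iY) (ideal-tail x r z Z iZ) P⊆Y∪Z
  ... | inj₁ P⊆Y = inj₁ (extend-⊆ x r P y Y iY P⊆Y)
  ... | inj₂ P⊆Z = inj₂ (extend-⊆ x r P z Z iZ P⊆Z)

  joinPrime-first : ∀ x r → JoinPrime (x ∷ r) (true ∷ˢ empty r)
  joinPrime-first x r (true ∷ˢ Y) (z ∷ˢ Z) _ _ _ = inj₁ ((λ _ → refl) , empty-⊆ Y)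
  joinPrime-first x r (false ∷ˢ Y) (z ∷ˢ Z) _ _ (first , _) = inj₂ ((λ _ → first refl) , empty-⊆ Z)

  principals-joinPrime : ∀ r → All (JoinPrime r) (principals r)
  principals-joinPrime [] = []
  principals-joinPrime (x ∷ r) = joinPrime-first x r ∷ All-map⁺ (All.map (joinPrime-extend x r _) (principals-joinPrime r))

  -- Every nonempty ideal S decomposes along some principal ideal P: S = S′ ∪ P with S′ ≠ S an ideal.
  -- Take P principal for the last chosen position, and S′ = S without that position.

  Decomposes : ∀ r → Sel r → Sel r → Set
  Decomposes r S P = Ideal r P × Σ (Sel r) λ S′ → Ideal r S′ × (S′ ≢ S) × (S′ ∪ˢ P ≡ S)

  noneChosen? : ∀ {r} (S : Sel r) → Dec (NoneChosen S)
  noneChosen? stop = yes tt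
  noneChosen? (true ∷ˢ S) = no (λ ())
  noneChosen? (false ∷ˢ S) = noneChosen? S

  decomposes-extend : ∀ x r b S P → Ideal (x ∷ r) (b ∷ˢ S) → Decomposes r S P → Decomposes (x ∷ r) (b ∷ˢ S) (extend x r P)
  decomposes-extend x r b S P iS (iP , S′ , iS′ , S′≢S , S′∪P≡S) =
    ideal-extend x r P iP , b ∷ˢ S′ , ideal-head b iS , (λ e → S′≢S (∷ˢ-injective e)) , union b iS
    where
    S′⊆S : S′ ⊆ˢ S
    S′⊆S = proj₁ (∪-⊆ S′ P S S′∪P≡S)
    ideal-head : ∀ b → Ideal (x ∷ r) (b ∷ˢ S) → Ideal (x ∷ r) (b ∷ˢ S′)
    ideal-head true _ = iS′
    ideal-head false (al , _) = chosen-⊆ r S′ S S′⊆S al , iS′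
    union : ∀ b → Ideal (x ∷ r) (b ∷ˢ S) → (b ∷ˢ S′) ∪ˢ extend x r P ≡ b ∷ˢ S
    union true _ = cong (true ∷ˢ_) S′∪P≡S
    union false (al , _) with All.all? (Indep? x) (chosen r P)
    ... | yes _ = cong (false ∷ˢ_) S′∪P≡S
    ... | no ¬al = ⊥-elim (¬al (chosen-⊆ r P S (proj₂ (∪-⊆ S′ P S S′∪P≡S)) al))

  decompose : ∀ r S → Ideal r S → ¬ NoneChosen S → Any (Decomposes r S) (principals r)
  decompose [] stop _ ne = ⊥-elim (ne tt)
  decompose (x ∷ r) (b ∷ˢ S) iS ne with noneChosen? S
  ... | no neS = there (Any-map⁺ (Any.map (decomposes-extend x r b S _ iS) (decompose r S (ideal-tail x r b S iS) neS)))
  decompose (x ∷ r) (false ∷ˢ S) iS ne | yes none = ⊥-elim (ne none)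
  decompose (x ∷ r) (true ∷ˢ S) iS ne | yes none =
    here (ideal-empty r , false ∷ˢ S , (subst (All (Indep x)) (sym (chosen-none r S none)) [] , iS) , (λ ()) ,
          cong (true ∷ˢ_) (∪-empty S))

  restrict : ∀ r → Sel r → (B : Sel r) → Sel (chosen r B)
  restrict [] stop stop = stop
  restrict (x ∷ r) (a ∷ˢ A) (true ∷ˢ B) = a ∷ˢ restrict r A B
  restrict (x ∷ r) (a ∷ˢ A) (false ∷ˢ B) = restrict r A B

  chosen-restrict : ∀ r A B → A ⊆ˢ B → chosen (chosen r B) (restrict r A B) ≡ chosen r A
  chosen-restrict [] stop stop _ = refl
  chosen-restrict (x ∷ r) (true ∷ˢ A) (true ∷ˢ B) (_ , s) = cong (x ∷_) (chosen-restrict r A B s)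
  chosen-restrict (x ∷ r) (false ∷ˢ A) (true ∷ˢ B) (_ , s) = chosen-restrict r A B s
  chosen-restrict (x ∷ r) (false ∷ˢ A) (false ∷ˢ B) (_ , s) = chosen-restrict r A B s
  chosen-restrict (x ∷ r) (true ∷ˢ A) (false ∷ˢ B) (h , s) with h refl
  ... | ()

  ideal-restrict : ∀ r A B → Ideal r A → A ⊆ˢ B → Ideal (chosen r B) (restrict r A B)
  ideal-restrict [] stop stop _ _ = tt
  ideal-restrict (x ∷ r) (true ∷ˢ A) (true ∷ˢ B) i (_ , s) = ideal-restrict r A B i s
  ideal-restrict (x ∷ r) (false ∷ˢ A) (true ∷ˢ B) (al , i) (_ , s) =
    subst (All (Indep x)) (sym (chosen-restrict r A B s)) al , ideal-restrict r A B i s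
  ideal-restrict (x ∷ r) (false ∷ˢ A) (false ∷ˢ B) (al , i) (_ , s) = ideal-restrict r A B i s
  ideal-restrict (x ∷ r) (true ∷ˢ A) (false ∷ˢ B) i (h , s) with h refl
  ... | ()

  ≤-≈ˡ : ∀ {a b c} → a ≈G b → b ≤G c → a ≤G c
  ≤-≈ˡ ab (u , t , ru , rut , ub , utc) = u , t , ru , rut , ≈trans ub (≈sym ab) , utc

  ≤-≈ʳ : ∀ {a b c} → a ≤G b → b ≈G c → a ≤G c
  ≤-≈ʳ (u , t , ru , rut , ua , utb) bc = u , t , ru , rut , ua , ≈trans utb bc

  prefix-≤ : ∀ u t → Reduced′ (u ++ t) → u ≤G u ++ t
  prefix-≤ u t r = u , t , Reduced′⇒Reduced u (reduced′-prefix u t r) , Reduced′⇒Reduced (u ++ t) r , ≈refl , ≈refl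

  isJoin-≈ : ∀ {a b c c′} → IsJoin a b c → c ≈G c′ → IsJoin a b c′
  isJoin-≈ (la , lb , least) cc′ = ≤-≈ʳ la cc′ , ≤-≈ʳ lb cc′ , λ w aw bw → ≤-≈ˡ (≈sym cc′) (least w aw bw)

  ideal-chosen-reduced : ∀ w S → Reduced′ w → Ideal w S → Reduced′ (chosen w S)
  ideal-chosen-reduced w S rw iS = reduced′-prefix (chosen w S) (unchosen w S) (reduced′-~ (ideal-split w S iS) rw)

  ideal-≤-word : ∀ w S → Reduced′ w → Ideal w S → chosen w S ≤G w
  ideal-≤-word w S rw iS = ≤-≈ʳ (prefix-≤ (chosen w S) (unchosen w S) (reduced′-~ split rw)) (~⇒≈ (~sym split))
    where
    split : w ~ (chosen w S ++ unchosen w S)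
    split = ideal-split w S iS

  module Ideals (r : Word) (reduced-r : Reduced′ r) where

    chosen-reduced : ∀ S → Ideal r S → Reduced′ (chosen r S)
    chosen-reduced S = ideal-chosen-reduced r S reduced-r

    ideal-injective : ∀ S T → Ideal r S → Ideal r T → chosen r S ≈G chosen r T → S ≡ T
    ideal-injective S T iS iT e = begin
      S                              ≡⟨ firsts-count r S iS ⟨
      firsts r (count (chosen r S))  ≡⟨ firsts-agree r _ _ (agree-all r (≡π-count same-counts)) ⟩
      firsts r (count (chosen r T))  ≡⟨ firsts-count r T iT ⟩
      T                              ∎
      where
      open ≡-Reasoning
      same-counts : chosen r S ≡π chosen r T
      same-counts = reduced-≈⇒≡π (chosen-reduced S iS) (chosen-reduced T iT) e

    ideal-≤ : ∀ Y U → Ideal r Y → Ideal r U → Y ⊆ˢ U → chosen r Y ≤G chosen r U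
    ideal-≤ Y U iY iU Y⊆U =
      subst (_≤G chosen r U) (chosen-restrict r Y U Y⊆U)
        (ideal-≤-word (chosen r U) (restrict r Y U) (chosen-reduced U iU) (ideal-restrict r Y U iY Y⊆U))

    -- everything below an ideal T is represented by an ideal inside T: a reduced word u
    -- below T is a prefix of r in G, so it is chosen by the ideal of the first (count u) letters
    below-ideal : ∀ T w z → Ideal r T → w ≤G z → z ≈G chosen r T →
                  Σ (Sel r) λ Y → Ideal r Y × (Y ⊆ˢ T) × (w ≈G chosen r Y)
    below-ideal T w z iT (u , t , _ , rut , uw , utz) zT =
      firsts r (count u) , proj₁ u-ideal , u⊆T , ≈trans (≈sym uw) (≡π⇒≈ (proj₂ u-ideal))
      where
      ut≡T : (u ++ t) ≡π chosen r T
      ut≡T = reduced-≈⇒≡π (Reduced⇒Reduced′ (u ++ t) rut) (chosen-reduced T iT) (≈trans utz zT)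
      u-prefix : (u ++ (t ++ unchosen r T)) ≡π r
      u-prefix = ≡π-trans (≡π-≡ (sym (++-assoc u t (unchosen r T))))
                   (≡π-trans (≡π-++ ut≡T (≡π-refl {unchosen r T})) (≡π-sym (~⇒≡π (ideal-split r T iT))))
      u-ideal : Ideal r (firsts r (count u)) × (u ≡π chosen r (firsts r (count u)))
      u-ideal = prefix-ideal r u (t ++ unchosen r T) u-prefix
      u⊆T : firsts r (count u) ⊆ˢ T
      u⊆T = subst (firsts r (count u) ⊆ˢ_) (firsts-count r T iT)
              (firsts-mono r (count u) (count (chosen r T)) λ y →
                subst (count u y ≤_) (trans (sym (count-++ u t y)) (≡π-count ut≡T y)) (m≤m+n (count u y) (count t y)))

    proj-∪ : ∀ A B → Ideal r A → Ideal r B → ∀ c d → Dep c d →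
             proj c d (chosen r (A ∪ˢ B)) ≡ longer (proj c d (chosen r A)) (proj c d (chosen r B))
    proj-∪ A B iA iB c d dcd =
      subst (λ S → proj c d (chosen r S) ≡ longer (proj c d (chosen r A)) (proj c d (chosen r B))) union
        (proj₂ (join-ideal r (chosen r A) (unchosen r A) (chosen r B) (unchosen r B)
                  (≡π-sym (~⇒≡π (ideal-split r A iA))) (≡π-sym (~⇒≡π (ideal-split r B iB)))) c d dcd)
      where
      union : firsts r (countMax (chosen r A) (chosen r B)) ≡ A ∪ˢ B
      union = trans (sym (firsts-⊔ r (count (chosen r A)) (count (chosen r B))))
                    (cong₂ _∪ˢ_ (firsts-count r A iA) (firsts-count r B iB))

    -- an upper bound w of two ideals is above their union: inside a reduced word q for w, the
    -- two ideals are prefixes, and their join in q has the same projections as the union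
    join-least : ∀ A B → Ideal r A → Ideal r B → ∀ w → chosen r A ≤G w → chosen r B ≤G w → chosen r (A ∪ˢ B) ≤G w
    join-least A B iA iB w (u₁ , t₁ , ru₁ , rq , u₁A , qw) (u₂ , t₂ , ru₂ , rut₂ , u₂B , ut₂w) =
      ≤-≈ˡ (≡π⇒≈ (≡π-sym same)) (≤-≈ʳ (ideal-≤-word q U q-reduced (proj₁ join-in-q)) qw)
      where
      q : Word
      q = u₁ ++ t₁
      q-reduced : Reduced′ q
      q-reduced = Reduced⇒Reduced′ q rq
      u₂-prefix : (u₂ ++ t₂) ≡π q
      u₂-prefix = reduced-≈⇒≡π (Reduced⇒Reduced′ (u₂ ++ t₂) rut₂) q-reduced (≈trans ut₂w (≈sym qw))
      U : Sel q
      U = firsts q (countMax u₁ u₂)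
      join-in-q : Ideal q U × (∀ c d → Dep c d → proj c d (chosen q U) ≡ longer (proj c d u₁) (proj c d u₂))
      join-in-q = join-ideal q u₁ t₁ u₂ t₂ ≡π-refl u₂-prefix
      a₁ : u₁ ≡π chosen r A
      a₁ = reduced-≈⇒≡π (Reduced⇒Reduced′ u₁ ru₁) (chosen-reduced A iA) u₁A
      a₂ : u₂ ≡π chosen r B
      a₂ = reduced-≈⇒≡π (Reduced⇒Reduced′ u₂ ru₂) (chosen-reduced B iB) u₂B
      same : chosen q U ≡π chosen r (A ∪ˢ B)
      same = π-equal λ c d dcd → trans (proj₂ join-in-q c d dcd)
               (trans (cong₂ longer (at a₁ c d dcd) (at a₂ c d dcd)) (sym (proj-∪ A B iA iB c d dcd)))

    ideal-join : ∀ A B → Ideal r A → Ideal r B → IsJoin (chosen r A) (chosen r B) (chosen r (A ∪ˢ B))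
    ideal-join A B iA iB =
      ideal-≤ A (A ∪ˢ B) iA iAB (⊆-∪ˡ A B) , ideal-≤ B (A ∪ˢ B) iB iAB (⊆-∪ʳ A B) , join-least A B iA iB
      where
      iAB : Ideal r (A ∪ˢ B)
      iAB = ideal-∪ r A B iA iB

    ≤⇒⊆ : ∀ S T → Ideal r S → Ideal r T → chosen r S ≤G chosen r T → S ⊆ˢ T
    ≤⇒⊆ S T iS iT S≤T with below-ideal T (chosen r S) (chosen r T) iT S≤T ≈refl
    ... | W , iW , W⊆T , SW = subst (_⊆ˢ T) (sym (ideal-injective S W iS iW SW)) W⊆T

    nonempty-≉1 : ∀ P → Ideal r P → ¬ NoneChosen P → ¬ (chosen r P ≈G [])
    nonempty-≉1 P iP ne e = ne (noneChosen-length r P (≡π-length (reduced-≈⇒≡π (chosen-reduced P iP) tt e)))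

    -- A nonempty join-prime ideal P represents a join-irreducible element: if y ∨ z = P, then y and z
    -- are represented by ideals Y, Z ⊆ P, and P ⊆ Y ∪ Z because P lies below every upper bound;
    -- hence P ⊆ Y or P ⊆ Z, i.e. y = P or z = P.
    joinPrime⇒joinIrreducible : ∀ P → Ideal r P → ¬ NoneChosen P → JoinPrime r P → JoinIrreducible (chosen r P)
    joinPrime⇒joinIrreducible P iP ne prime = nonempty-≉1 P iP ne , split
      where
      split : ∀ y z → IsJoin y z (chosen r P) → (y ≈G chosen r P) ⊎ (z ≈G chosen r P)
      split y z (y≤P , z≤P , least)
        with below-ideal P y (chosen r P) iP y≤P ≈refl | below-ideal P z (chosen r P) iP z≤P ≈refl
      ... | Y , iY , Y⊆P , yY | Z , iZ , Z⊆P , zZ = conclude (prime Y Z iY iZ P⊆Y∪Z)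
        where
        iY∪Z : Ideal r (Y ∪ˢ Z)
        iY∪Z = ideal-∪ r Y Z iY iZ
        P⊆Y∪Z : P ⊆ˢ Y ∪ˢ Z
        P⊆Y∪Z = ≤⇒⊆ P (Y ∪ˢ Z) iP iY∪Z (least (chosen r (Y ∪ˢ Z))
                  (≤-≈ˡ yY (ideal-≤ Y (Y ∪ˢ Z) iY iY∪Z (⊆-∪ˡ Y Z)))
                  (≤-≈ˡ zZ (ideal-≤ Z (Y ∪ˢ Z) iZ iY∪Z (⊆-∪ʳ Y Z))))
        conclude : (P ⊆ˢ Y) ⊎ (P ⊆ˢ Z) → (y ≈G chosen r P) ⊎ (z ≈G chosen r P)
        conclude (inj₁ P⊆Y) = inj₁ (subst (λ S → y ≈G chosen r S) (⊆-antisym Y P Y⊆P P⊆Y) yY)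
        conclude (inj₂ P⊆Z) = inj₂ (subst (λ S → z ≈G chosen r S) (⊆-antisym Z P Z⊆P P⊆Z) zZ)

    -- A join-irreducible y ≤ r is represented by a principal ideal: its ideal S is the union of a
    -- proper sub-ideal S′ and a principal ideal P, and irreducibility forces y = P.
    joinIrreducible⇒principal : ∀ y → JoinIrreducible y → y ≤G r → Any (λ P → y ≈G chosen r P) (principals r)
    joinIrreducible⇒principal y (y≉1 , irreducible) y≤r
      with below-ideal (full r) y r (ideal-full r) y≤r (subst (r ≈G_) (sym (chosen-full r)) ≈refl)
    ... | S , iS , _ , yS = Any.map pick (decompose r S iS nonempty)
      where
      nonempty : ¬ NoneChosen S
      nonempty none = y≉1 (≈trans yS (subst (chosen r S ≈G_) (chosen-none r S none) ≈refl))
      pick : ∀ {P} → Decomposes r S P → y ≈G chosen r P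
      pick {P} (iP , S′ , iS′ , S′≢S , S′∪P≡S)
        with irreducible (chosen r S′) (chosen r P)
               (isJoin-≈ (subst (λ T → IsJoin (chosen r S′) (chosen r P) (chosen r T)) S′∪P≡S (ideal-join S′ P iS′ iP))
                         (≈sym yS))
      ... | inj₂ Py = ≈sym Py
      ... | inj₁ S′y = ⊥-elim (S′≢S (ideal-injective S′ S iS′ iS (≈trans S′y yS)))

    principals-joinIrreducible : All (λ P → JoinIrreducible (chosen r P) × (chosen r P ≤G r)) (principals r)
    principals-joinIrreducible =
      All.zipWith (λ {P} (iP , ne , prime) → joinPrime⇒joinIrreducible P iP ne prime , ideal-≤-word r P reduced-r iP)
        (principals-ideal r , All.zip (principals-nonempty r , principals-joinPrime r))

    principals-distinct-in-G : AllPairs (λ P P′ → ¬ (chosen r P ≈G chosen r P′)) (principals r)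
    principals-distinct-in-G = distinct-ideals (principals-ideal r) (principals-distinct r)
      where
      distinct-ideals : ∀ {Ps} → All (Ideal r) Ps → AllPairs _≢_ Ps →
                        AllPairs (λ P P′ → ¬ (chosen r P ≈G chosen r P′)) Ps
      distinct-ideals [] [] = []
      distinct-ideals {P ∷ _} (iP ∷ iPs) (P≢ ∷ Ps≢) =
        All.zipWith (λ {P′} (iP′ , P≢P′) e → P≢P′ (ideal-injective P P′ iP iP′ e)) (iPs , P≢) ∷ distinct-ideals iPs Ps≢

mainTheorem14 : (k : ℕ) (E : Fin k → Fin k → Bool) →
    let open FPCG k E in
    (x r : Word) → Reduced r → r ≈G x →
    Σ (List Word) λ ys →
      (length ys ≡ length r)
      × All (λ y → JoinIrreducible y × (y ≤G x)) ys
      × AllPairs (λ y y′ → ¬ (y ≈G y′)) ys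
      × (∀ y → JoinIrreducible y → y ≤G x → Any (λ y′ → y ≈G y′) ys)
mainTheorem14 k E x r reduced r≈x =
  map (chosen r) (principals r) ,
  trans (length-map (chosen r) (principals r)) (principals-length r) ,
  All-map⁺ (All.map (λ (irreducible , ≤r) → irreducible , ≤-≈ʳ ≤r r≈x) principals-joinIrreducible) ,
  AllPairs-map⁺ principals-distinct-in-G ,
  λ y irreducible y≤x → Any-map⁺ (joinIrreducible⇒principal y irreducible (≤-≈ʳ y≤x (≈sym r≈x)))
  where
  open FPCG k E
  open Development k E
  open Ideals r (Reduced⇒Reduced′ r reduced)
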